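{- Let $m>16$ be a square-free integer with $-m\equiv1\pmod 8$, and $K=\mathbb{Q}(\sqrt{ -m})$. Then, for any choice of lifting $l$, $2\notin L_0$, and $E\subsetneq Cl(K)$.
   Context: Let $\mathcal{O}_K$ be the ring of integers of $K$, $Cl(K)$ its class group, $\mathbb{P}$ the set of rational primes, $P(\mathcal{O}_K)$ the set of nonzero prime ideals, $\mu:P(\mathcal{O}_K)\to\mathbb{P}$ the map to the prime lying below, $\pi:P(\mathcal{O}_K)\to Cl(K)$ the class map. A lifting is a map $l:\mathbb{P}\to P(\mathcal{O}_K)$ with $\mu\circ l=\mathrm{id}$; set $f=\pi\circ l$. Let $E=\{x\in Cl(K):x^2=1\}$. Let $L$ be the set of primes $p$ with Kronecker symbol $\left(\frac{ -m}{p}\right)=1$ (Legendre symbol for odd $p$; for $p=2$ the condition is $-m\equiv1\pmod 8$), and $L_0=f^{ -1}(E)\cap L$. -}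

module Defs where

open import Data.Nat as ℕ using (ℕ; suc; _/_)
open import Data.Nat.Divisibility using (_∣_)
open import Data.Nat.Primality using (Prime)
open import Data.Integer as ℤ using (ℤ; +_)
open import Data.Product using (Σ; ∃; _×_; _,_)
open import Data.Sum using (_⊎_)
open import Data.List using (List; []; _∷_)
open import Data.Empty using (⊥)
open import Relation.Nullary using (¬_)
open import Relation.Binary.PropositionalEquality using (_≡_; _≢_)

SquareFree : ℕ → Set
SquareFree m = ∀ d → (d ℕ.* d) ∣ m → d ≡ 1

-- For -m ≡ 1 (mod 4), O_K = ℤ[ω] with ω = (1 + √-m)/2, ω² = ω - k, k = (m+1)/4.
-- An element a + bω is represented by the pair (a , b).
OK : Set
OK = ℤ × ℤ

kOf : ℕ → ℤ
kOf m = + (suc m / 4)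

module _ (m : ℕ) where

  0K 1K : OK
  0K = (+ 0 , + 0)
  1K = (+ 1 , + 0)

  _+K_ : OK → OK → OK
  (a , b) +K (c , d) = (a ℤ.+ c , b ℤ.+ d)

  -- (a + bω)(c + dω) = (ac - k bd) + (ad + bc + bd) ω
  _*K_ : OK → OK → OK
  (a , b) *K (c , d) =
    (a ℤ.* c ℤ.- kOf m ℤ.* (b ℤ.* d) , a ℤ.* d ℤ.+ b ℤ.* c ℤ.+ b ℤ.* d)

  ofℕ : ℕ → OK
  ofℕ n = (+ n , + 0)

  Sub : Set₁
  Sub = OK → Set

  record Ideal : Set₁ where
    field
      mem  : Sub
      0∈   : mem 0K
      +∈   : ∀ {x y} → mem x → mem y → mem (x +K y)
      *∈   : ∀ r {x} → mem x → mem (r *K x)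
  open Ideal public

  NonzeroSub : Sub → Set
  NonzeroSub I = Σ OK λ x → I x × (x ≢ 0K)

  IsNonzeroPrime : Ideal → Set
  IsNonzeroPrime P =
    NonzeroSub (mem P) × (¬ mem P 1K) × (∀ x y → mem P (x *K y) → mem P x ⊎ mem P y)

  LiesAbove : Ideal → ℕ → Set
  LiesAbove P p = mem P (ofℕ p)

  sumK : List OK → OK
  sumK []       = 0K
  sumK (x ∷ xs) = x +K sumK xs

  AllIn : Sub → Sub → List (OK × OK) → Set
  AllIn I J []             = Data.Unit.⊤
    where import Data.Unit
  AllIn I J ((a , b) ∷ ps) = I a × J b × AllIn I J ps

  prods : List (OK × OK) → List OK
  prods []             = []
  prods ((a , b) ∷ ps) = (a *K b) ∷ prods ps

  _·_ : Sub → Sub → Sub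
  (I · J) x = Σ (List (OK × OK)) λ ps → AllIn I J ps × sumK (prods ps) ≡ x

  scale : OK → Sub → Sub
  scale α I x = Σ OK λ y → I y × x ≡ α *K y

  SameClass : Sub → Sub → Set
  SameClass I J = Σ OK λ α → Σ OK λ β → α ≢ 0K × β ≢ 0K ×
    (∀ x → (scale α I x → scale β J x) × (scale β J x → scale α I x))

  Unit : Sub
  Unit _ = Data.Unit.⊤
    where import Data.Unit

  -- the class of the ideal I squares to the identity of Cl(K), i.e. [I] ∈ E
  ClassInE : Sub → Set
  ClassInE I = SameClass (I · I) Unit

  -- Kronecker symbol (-m/p) = 1
  InL : ℕ → Set
  InL p = (p ≡ 2 × 8 ∣ suc m)
        ⊎ (p ≢ 2 × ¬ (p ∣ m) × ∃ λ x → p ∣ (x ℕ.* x ℕ.+ m))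

  record Lifting : Set₁ where
    field
      lift      : (p : ℕ) → Prime p → Ideal
      liftPrime : ∀ p (pp : Prime p) → IsNonzeroPrime (lift p pp)
      liftAbove : ∀ p (pp : Prime p) → LiesAbove (lift p pp) p
  open Lifting public

  InL0 : Lifting → (p : ℕ) → Prime p → Set
  InL0 l p pp = ClassInE (mem (lift l p pp)) × InL p

  EProper : Set₁
  EProper = Σ Ideal λ I → NonzeroSub (mem I) × ¬ ClassInE (mem I)

-- Since 8 ∣ m + 1, the integer k = (m + 1)/4 with ω² = ω - k is even, so there are two ring maps
-- O_K → 𝔽₂, sending ω to 0 or to 1; their kernels 𝔭_c = (2, c - ω) are the primes above 2, and the
-- prime l(2) is one of them. The square 𝔭_c² contains 4 and (c - ω)², whose ω-coordinate is odd,
-- while its rational elements are even. A generator x of 𝔭_c² would divide 4, and by the norm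
-- 4 N(a + bω) = (2a + b)² + m b² every divisor of 4 is rational once m > 16; but a rational
-- x ∈ 𝔭_c² is even and cannot divide (c - ω)². So [𝔭_c]² ≠ 1, which gives both claims.
{-# OPTIONS --safe #-}
module Submission where

open import Defs
open import Data.Nat using (ℕ; _<_; suc)
open import Data.Nat.Divisibility using (_∣_)
open import Data.Nat.Primality using (Prime)
open import Data.Product using (_×_)
open import Relation.Nullary using (¬_)

open import Data.Nat as ℕ using (zero; _≤_; s≤s)
import Data.Nat.Properties as ℕₚ
import Data.Nat.Divisibility as ℕ∣
open import Data.Nat.DivMod using (m*n/n≡m)
open import Data.Integer as ℤ using (ℤ; +_; -[1+_]; ∣_∣)
import Data.Integer.Properties as ℤₚ
import Data.Integer.Divisibility.Signed as ℤ∣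
open import Data.Integer.DivMod using (_%ℕ_; _/ℕ_; n%ℕd<d; a≡a%ℕn+[a/ℕn]*n)
open import Data.Integer.Tactic.RingSolver using (solve-∀)
open import Data.Product using (Σ; _,_; proj₁; proj₂)
open import Data.Sum using (_⊎_; inj₁; inj₂; [_,_]′; reduce)
open import Data.Empty using (⊥-elim)
open import Data.Unit using (tt)
open import Data.List using ([]; _∷_)
open import Relation.Nullary using (yes; no; contradiction)
open import Relation.Binary.PropositionalEquality

Even : ℤ → Set
Even a = + 2 ℤ∣.∣ a

¬Even-1 : ¬ Even (+ 1)
¬Even-1 2∣1 = contradiction (ℕ∣.∣1⇒≡1 (ℤ∣.∣⇒∣ᵤ 2∣1)) (λ ())

¬Even-1+i*2 : ∀ i → ¬ Even (+ 1 ℤ.+ i ℤ.* + 2)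
¬Even-1+i*2 i 2∣1+2i = ¬Even-1 (ℤ∣.∣m+n∣n⇒∣m 2∣1+2i (ℤ∣.divides i refl))

kOf-≡ : ∀ {m} k → suc m ≡ k ℕ.* 4 → kOf m ≡ + k
kOf-≡ k eq = cong +_ (trans (cong (ℕ._/ 4) eq) (m*n/n≡m k 4))

m≡4k-1 : ∀ {m} k → suc m ≡ k ℕ.* 4 → + m ≡ + 4 ℤ.* kOf m ℤ.- + 1
m≡4k-1 {m} k eq = begin
  + m                        ≡⟨ shift (+ m) ⟩
  + 1 ℤ.+ + m ℤ.- + 1        ≡⟨ cong (ℤ._- + 1) (trans (sym (ℤₚ.pos-+ 1 m)) (cong +_ eq)) ⟩
  + (k ℕ.* 4) ℤ.- + 1        ≡⟨ cong (ℤ._- + 1) (trans (ℤₚ.pos-* k 4) (ℤₚ.*-comm (+ k) (+ 4))) ⟩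
  + 4 ℤ.* + k ℤ.- + 1        ≡⟨ cong (λ k → + 4 ℤ.* k ℤ.- + 1) (sym (kOf-≡ k eq)) ⟩
  + 4 ℤ.* kOf m ℤ.- + 1      ∎
  where
  open ≡-Reasoning
  shift : ∀ x → x ≡ + 1 ℤ.+ x ℤ.- + 1
  shift = solve-∀

module Arithmetic (m : ℕ) where

  K : ℤ
  K = kOf m

  infixl 6 _⊕_ _⊝_
  infixl 7 _⊛_
  infix 5 _−ω

  _⊕_ _⊛_ _⊝_ : OK → OK → OK
  _⊕_ = _+K_ m
  _⊛_ = _*K_ m
  (a , b) ⊝ (c , d) = (a ℤ.- c , b ℤ.- d)

  _−ω : ℤ → OK
  c −ω = (c , -[1+ 0 ])

  ⊕-identityʳ : ∀ u → u ⊕ 0K m ≡ u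
  ⊕-identityʳ (a , b) = cong₂ _,_ (ℤₚ.+-identityʳ a) (ℤₚ.+-identityʳ b)

  ⊛-identityʳ : ∀ u → u ⊛ 1K m ≡ u
  ⊛-identityʳ (a , b) = cong₂ _,_ (first a b K) (second a b)
    where
    first : ∀ a b K → a ℤ.* + 1 ℤ.- K ℤ.* (b ℤ.* + 0) ≡ a
    first = solve-∀
    second : ∀ a b → a ℤ.* + 0 ℤ.+ b ℤ.* + 1 ℤ.+ b ℤ.* + 0 ≡ b
    second = solve-∀

  ⊛-assoc : ∀ u v w → (u ⊛ v) ⊛ w ≡ u ⊛ (v ⊛ w)
  ⊛-assoc (a , b) (c , d) (e , f) = cong₂ _,_ (first a b c d e f K) (second a b c d e f K)
    where
    first : ∀ a b c d e f K →
      (a ℤ.* c ℤ.- K ℤ.* (b ℤ.* d)) ℤ.* e ℤ.- K ℤ.* ((a ℤ.* d ℤ.+ b ℤ.* c ℤ.+ b ℤ.* d) ℤ.* f)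
      ≡ a ℤ.* (c ℤ.* e ℤ.- K ℤ.* (d ℤ.* f)) ℤ.- K ℤ.* (b ℤ.* (c ℤ.* f ℤ.+ d ℤ.* e ℤ.+ d ℤ.* f))
    first = solve-∀
    second : ∀ a b c d e f K →
      (a ℤ.* c ℤ.- K ℤ.* (b ℤ.* d)) ℤ.* f ℤ.+ (a ℤ.* d ℤ.+ b ℤ.* c ℤ.+ b ℤ.* d) ℤ.* e
        ℤ.+ (a ℤ.* d ℤ.+ b ℤ.* c ℤ.+ b ℤ.* d) ℤ.* f
      ≡ a ℤ.* (c ℤ.* f ℤ.+ d ℤ.* e ℤ.+ d ℤ.* f) ℤ.+ b ℤ.* (c ℤ.* e ℤ.- K ℤ.* (d ℤ.* f))
        ℤ.+ b ℤ.* (c ℤ.* f ℤ.+ d ℤ.* e ℤ.+ d ℤ.* f)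
    second = solve-∀

  ⊛-distribˡ-⊝ : ∀ α u v → α ⊛ (u ⊝ v) ≡ α ⊛ u ⊝ α ⊛ v
  ⊛-distribˡ-⊝ (x , y) (a , b) (c , d) = cong₂ _,_ (first x y a b c d K) (second x y a b c d)
    where
    first : ∀ x y a b c d K → x ℤ.* (a ℤ.- c) ℤ.- K ℤ.* (y ℤ.* (b ℤ.- d))
      ≡ (x ℤ.* a ℤ.- K ℤ.* (y ℤ.* b)) ℤ.- (x ℤ.* c ℤ.- K ℤ.* (y ℤ.* d))
    first = solve-∀
    second : ∀ x y a b c d → x ℤ.* (b ℤ.- d) ℤ.+ y ℤ.* (a ℤ.- c) ℤ.+ y ℤ.* (b ℤ.- d)
      ≡ (x ℤ.* b ℤ.+ y ℤ.* a ℤ.+ y ℤ.* b) ℤ.- (x ℤ.* d ℤ.+ y ℤ.* c ℤ.+ y ℤ.* d)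
    second = solve-∀

  ⊝-self : ∀ u → u ⊝ u ≡ 0K m
  ⊝-self (a , b) = cong₂ _,_ (ℤₚ.+-inverseʳ a) (ℤₚ.+-inverseʳ b)

  ⊝≡0⇒≡ : ∀ u v → u ⊝ v ≡ 0K m → u ≡ v
  ⊝≡0⇒≡ (a , b) (c , d) eq =
    cong₂ _,_ (ℤₚ.i-j≡0⇒i≡j a c (cong proj₁ eq)) (ℤₚ.i-j≡0⇒i≡j b d (cong proj₂ eq))

  norm : OK → ℤ
  norm (a , b) = a ℤ.* a ℤ.+ a ℤ.* b ℤ.+ K ℤ.* (b ℤ.* b)

  norm-⊛ : ∀ u v → norm (u ⊛ v) ≡ norm u ℤ.* norm v
  norm-⊛ (a , b) (c , d) = multiplicative a b c d K
    where
    multiplicative : ∀ a b c d K →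
      let x = a ℤ.* c ℤ.- K ℤ.* (b ℤ.* d) ; y = a ℤ.* d ℤ.+ b ℤ.* c ℤ.+ b ℤ.* d in
      x ℤ.* x ℤ.+ x ℤ.* y ℤ.+ K ℤ.* (y ℤ.* y)
      ≡ (a ℤ.* a ℤ.+ a ℤ.* b ℤ.+ K ℤ.* (b ℤ.* b)) ℤ.* (c ℤ.* c ℤ.+ c ℤ.* d ℤ.+ K ℤ.* (d ℤ.* d))
    multiplicative = solve-∀

  ∈· : (I J : Sub m) → ∀ {x y} → I x → J y → _·_ m I J (x ⊛ y)
  ∈· I J {x} {y} x∈I y∈J = (x , y) ∷ [] , (x∈I , y∈J , tt) , ⊕-identityʳ (x ⊛ y)

  ·-⊆ʳ : (I J : Sub m) (Q : Ideal m) → (∀ {x} → J x → mem Q x) → ∀ {x} → _·_ m I J x → mem Q x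
  ·-⊆ʳ I J Q J⊆Q (ps , ps∈ , refl) = sum∈ ps ps∈
    where
    sum∈ : ∀ ps → AllIn m I J ps → mem Q (sumK m (prods m ps))
    sum∈ []             _                = 0∈ Q
    sum∈ ((x , y) ∷ ps) (_ , y∈J , ps∈) = +∈ Q (*∈ Q x (J⊆Q y∈J)) (sum∈ ps ps∈)

  -- The image of u under the ring map O_K → ℤ/2 sending ω to c, which exists when c is a root
  -- of X² - X + k modulo 2.
  eval : ℤ → OK → ℤ
  eval c (a , b) = a ℤ.+ c ℤ.* b

  Root : ℤ → Set
  Root c = Even (c ℤ.* c ℤ.- c ℤ.+ K)

  eval-⊛ : ∀ c u v →
    eval c (u ⊛ v) ≡ eval c u ℤ.* eval c v ℤ.- proj₂ u ℤ.* proj₂ v ℤ.* (c ℤ.* c ℤ.- c ℤ.+ K)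
  eval-⊛ c (a , b) (d , e) = identity a b d e c K
    where
    identity : ∀ a b d e c K →
      a ℤ.* d ℤ.- K ℤ.* (b ℤ.* e) ℤ.+ c ℤ.* (a ℤ.* e ℤ.+ b ℤ.* d ℤ.+ b ℤ.* e)
      ≡ (a ℤ.+ c ℤ.* b) ℤ.* (d ℤ.+ c ℤ.* e) ℤ.- b ℤ.* e ℤ.* (c ℤ.* c ℤ.- c ℤ.+ K)
    identity = solve-∀

  𝔭 : (c : ℤ) → Root c → Ideal m
  𝔭 c root = record
    { mem = λ u → Even (eval c u)
    ; 0∈  = ℤ∣.divides (+ 0) (zero-eval c)
    ; +∈  = λ {u} {v} u∈ v∈ → subst Even (sym (additive u v)) (ℤ∣.∣m∣n⇒∣m+n u∈ v∈)
    ; *∈  = λ r {u} u∈ → subst Even (sym (eval-⊛ c r u))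
        (ℤ∣.∣m∣n⇒∣m-n (ℤ∣.∣n⇒∣m*n (eval c r) u∈) (ℤ∣.∣n⇒∣m*n (proj₂ r ℤ.* proj₂ u) root))
    }
    where
    zero-eval : ∀ c → + 0 ℤ.+ c ℤ.* + 0 ≡ + 0 ℤ.* + 2
    zero-eval = solve-∀
    additive : ∀ u v → eval c (u ⊕ v) ≡ eval c u ℤ.+ eval c v
    additive (a , b) (d , e) = identity a b d e c
      where
      identity : ∀ a b d e c → a ℤ.+ d ℤ.+ c ℤ.* (b ℤ.+ e) ≡ a ℤ.+ c ℤ.* b ℤ.+ (d ℤ.+ c ℤ.* e)
      identity = solve-∀

  Even-eval-rational : ∀ c a → Even (eval c (a , + 0)) → Even a
  Even-eval-rational c a = subst Even (trans (cong (λ t → a ℤ.+ t) (ℤₚ.*-zeroʳ c)) (ℤₚ.+-identityʳ a))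

  ∈-rational⇒Even : (P : Ideal m) → mem P (+ 2 , + 0) → ¬ mem P (1K m) →
                    ∀ n → mem P (n , + 0) → Even n
  ∈-rational⇒Even P 2∈P 1∉P n = byRemainder n (n %ℕ 2) (n /ℕ 2) (n%ℕd<d n 2) (a≡a%ℕn+[a/ℕn]*n n 2)
    where
    first : ∀ q K → (+ 1 ℤ.+ q ℤ.* + 2) ℤ.+ (ℤ.- q ℤ.* + 2 ℤ.- K ℤ.* (+ 0 ℤ.* + 0)) ≡ + 1
    first = solve-∀
    second : ∀ q → + 0 ℤ.+ (ℤ.- q ℤ.* + 0 ℤ.+ + 0 ℤ.* + 2 ℤ.+ + 0 ℤ.* + 0) ≡ + 0
    second = solve-∀
    byRemainder : ∀ n r q → r < 2 → n ≡ + r ℤ.+ q ℤ.* + 2 → mem P (n , + 0) → Even n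
    byRemainder _ 0 q _ refl _ = ℤ∣.divides q (ℤₚ.+-identityˡ (q ℤ.* + 2))
    byRemainder _ 1 q _ refl n∈P = contradiction
      (subst (mem P) (cong₂ _,_ (first q K) (second q)) (+∈ P n∈P (*∈ P (ℤ.- q , + 0) 2∈P))) 1∉P
    byRemainder _ (suc (suc _)) _ (s≤s (s≤s ())) _ _

  ⊆𝔭 : (P : Ideal m) → mem P (+ 2 , + 0) → ¬ mem P (1K m) →
       ∀ c → mem P (c −ω) → ∀ {u} → mem P u → Even (eval c u)
  ⊆𝔭 P 2∈P 1∉P c w∈P {u} u∈P = ∈-rational⇒Even P 2∈P 1∉P (eval c u)
    (subst (mem P) (clear-ω u) (+∈ P u∈P (*∈ P (proj₂ u , + 0) w∈P)))
    where
    clear-ω : ∀ u → u ⊕ (proj₂ u , + 0) ⊛ (c −ω) ≡ (eval c u , + 0)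
    clear-ω (a , b) = cong₂ _,_ (first a b c K) (second b c)
      where
      first : ∀ a b c K → a ℤ.+ (b ℤ.* c ℤ.- K ℤ.* (+ 0 ℤ.* -[1+ 0 ])) ≡ a ℤ.+ c ℤ.* b
      first = solve-∀
      second : ∀ b c → b ℤ.+ (b ℤ.* -[1+ 0 ] ℤ.+ + 0 ℤ.* c ℤ.+ + 0 ℤ.* -[1+ 0 ]) ≡ + 0
      second = solve-∀

  2⊛2≡4 : (+ 2 , + 0) ⊛ (+ 2 , + 0) ≡ (+ 4 , + 0)
  2⊛2≡4 = cong₂ _,_ (four K) refl
    where
    four : ∀ K → + 2 ℤ.* + 2 ℤ.- K ℤ.* (+ 0 ℤ.* + 0) ≡ + 4
    four = solve-∀

  ¬Even-ω-part-of-[c−ω]² : ∀ c → ¬ Even (proj₂ ((c −ω) ⊛ (c −ω)))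
  ¬Even-ω-part-of-[c−ω]² c even = ¬Even-1+i*2 (ℤ.- c) (subst Even (odd c) even)
    where
    odd : ∀ c → c ℤ.* -[1+ 0 ] ℤ.+ -[1+ 0 ] ℤ.* c ℤ.+ -[1+ 0 ] ℤ.* -[1+ 0 ] ≡ + 1 ℤ.+ ℤ.- c ℤ.* + 2
    odd = solve-∀

  prime-above-2 : Even K → (P : Ideal m) → IsNonzeroPrime m P → mem P (+ 2 , + 0) →
                  mem P (+ 0 −ω) ⊎ mem P (+ 1 −ω)
  prime-above-2 (ℤ∣.divides q K≡q*2) P (_ , _ , prime) 2∈P =
    prime _ _ (subst (mem P) (cong₂ _,_ first (second q)) (*∈ P (ℤ.- q , + 0) 2∈P))
    where
    open ≡-Reasoning
    second : ∀ q → ℤ.- q ℤ.* + 0 ℤ.+ + 0 ℤ.* + 2 ℤ.+ + 0 ℤ.* + 0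
                 ≡ + 0 ℤ.* -[1+ 0 ] ℤ.+ -[1+ 0 ] ℤ.* + 1 ℤ.+ -[1+ 0 ] ℤ.* -[1+ 0 ]
    second = solve-∀
    lhs≡-q*2 : ∀ q K → ℤ.- q ℤ.* + 2 ℤ.- K ℤ.* (+ 0 ℤ.* + 0) ≡ ℤ.- (q ℤ.* + 2)
    lhs≡-q*2 = solve-∀
    -K≡rhs : ∀ K → ℤ.- K ≡ + 0 ℤ.* + 1 ℤ.- K ℤ.* (-[1+ 0 ] ℤ.* -[1+ 0 ])
    -K≡rhs = solve-∀
    first : ℤ.- q ℤ.* + 2 ℤ.- K ℤ.* (+ 0 ℤ.* + 0) ≡ + 0 ℤ.* + 1 ℤ.- K ℤ.* (-[1+ 0 ] ℤ.* -[1+ 0 ])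
    first = begin
      ℤ.- q ℤ.* + 2 ℤ.- K ℤ.* (+ 0 ℤ.* + 0)          ≡⟨ lhs≡-q*2 q K ⟩
      ℤ.- (q ℤ.* + 2)                                ≡⟨ cong ℤ.-_ (sym K≡q*2) ⟩
      ℤ.- K                                          ≡⟨ -K≡rhs K ⟩
      + 0 ℤ.* + 1 ℤ.- K ℤ.* (-[1+ 0 ] ℤ.* -[1+ 0 ]) ∎

  Even-k⇒Root-0 : Even K → Root (+ 0)
  Even-k⇒Root-0 = subst Even (identity K)
    where
    identity : ∀ K → K ≡ + 0 ℤ.* + 0 ℤ.- + 0 ℤ.+ K
    identity = solve-∀

  Even-k⇒Root-1 : Even K → Root (+ 1)
  Even-k⇒Root-1 = subst Even (identity K)
    where
    identity : ∀ K → K ≡ + 1 ℤ.* + 1 ℤ.- + 1 ℤ.+ K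
    identity = solve-∀

module Classes (m : ℕ) (m≡4k-1 : + m ≡ + 4 ℤ.* kOf m ℤ.- + 1) (16<m : 16 < m) where
  open Arithmetic m

  -- 4 N(a + bω) as a natural number: the norm of 2(a + bω) = (2a + b) + b√-m.
  norm4 : OK → ℕ
  norm4 (a , b) = ∣ + 2 ℤ.* a ℤ.+ b ∣ ℕ.* ∣ + 2 ℤ.* a ℤ.+ b ∣ ℕ.+ m ℕ.* (∣ b ∣ ℕ.* ∣ b ∣)

  +norm4 : ∀ u → + norm4 u ≡ + 4 ℤ.* norm u
  +norm4 (a , b) = begin
    + norm4 (a , b)                                     ≡⟨ ℤₚ.pos-+ (∣ s ∣ ℕ.* ∣ s ∣) _ ⟩
    + (∣ s ∣ ℕ.* ∣ s ∣) ℤ.+ + (m ℕ.* (∣ b ∣ ℕ.* ∣ b ∣)) ≡⟨ cong₂ ℤ._+_ (square s)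
                                                            (trans (ℤₚ.pos-* m _) (cong₂ ℤ._*_ m≡4k-1 (square b))) ⟩
    s ℤ.* s ℤ.+ (+ 4 ℤ.* K ℤ.- + 1) ℤ.* (b ℤ.* b)        ≡⟨ identity a b K ⟩
    + 4 ℤ.* norm (a , b)                                ∎
    where
    open ≡-Reasoning
    s = + 2 ℤ.* a ℤ.+ b
    square : ∀ i → + (∣ i ∣ ℕ.* ∣ i ∣) ≡ i ℤ.* i
    square (+ n)    = ℤₚ.pos-* n n
    square -[1+ n ] = refl
    identity : ∀ a b K → (+ 2 ℤ.* a ℤ.+ b) ℤ.* (+ 2 ℤ.* a ℤ.+ b) ℤ.+ (+ 4 ℤ.* K ℤ.- + 1) ℤ.* (b ℤ.* b)
                         ≡ + 4 ℤ.* (a ℤ.* a ℤ.+ a ℤ.* b ℤ.+ K ℤ.* (b ℤ.* b))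
    identity = solve-∀

  norm4-⊛ : ∀ u v → 4 ℕ.* norm4 (u ⊛ v) ≡ norm4 u ℕ.* norm4 v
  norm4-⊛ u v = ℤₚ.+-injective (begin
    + (4 ℕ.* norm4 (u ⊛ v))                  ≡⟨ ℤₚ.pos-* 4 (norm4 (u ⊛ v)) ⟩
    + 4 ℤ.* + norm4 (u ⊛ v)                  ≡⟨ cong (+ 4 ℤ.*_) (trans (+norm4 (u ⊛ v)) (cong (+ 4 ℤ.*_) (norm-⊛ u v))) ⟩
    + 4 ℤ.* (+ 4 ℤ.* (norm u ℤ.* norm v))    ≡⟨ regroup (norm u) (norm v) ⟩
    (+ 4 ℤ.* norm u) ℤ.* (+ 4 ℤ.* norm v)    ≡⟨ sym (cong₂ ℤ._*_ (+norm4 u) (+norm4 v)) ⟩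
    + norm4 u ℤ.* + norm4 v                  ≡⟨ sym (ℤₚ.pos-* (norm4 u) (norm4 v)) ⟩
    + (norm4 u ℕ.* norm4 v)                  ∎)
    where
    open ≡-Reasoning
    regroup : ∀ x y → + 4 ℤ.* (+ 4 ℤ.* (x ℤ.* y)) ≡ (+ 4 ℤ.* x) ℤ.* (+ 4 ℤ.* y)
    regroup = solve-∀

  m≤norm4 : ∀ a b → b ≢ + 0 → m ≤ norm4 (a , b)
  m≤norm4 a b b≢0 = ℕₚ.≤-trans (m≤m*∣b∣² b b≢0) (ℕₚ.m≤n+m _ _)
    where
    m≤m*∣b∣² : ∀ b → b ≢ + 0 → m ≤ m ℕ.* (∣ b ∣ ℕ.* ∣ b ∣)
    m≤m*∣b∣² (+ zero)    b≢0 = contradiction refl b≢0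
    m≤m*∣b∣² (+ suc n)   _   = ℕₚ.m≤m*n m _
    m≤m*∣b∣² -[1+ n ]    _   = ℕₚ.m≤m*n m _

  norm4≡0⇒≡0 : ∀ u → norm4 u ≡ 0 → u ≡ 0K m
  norm4≡0⇒≡0 (a , b) N≡0 with b ℤ.≟ + 0
  ... | no b≢0  = contradiction (ℕₚ.≤-trans (subst (m ≤_) N≡0 (m≤norm4 a b b≢0)) ℕ.z≤n) (ℕₚ.<⇒≱ 16<m)
  ... | yes refl = cong₂ _,_ a≡0 refl
    where
    2a+0≡0 : + 2 ℤ.* a ℤ.+ + 0 ≡ + 0
    2a+0≡0 = ℤₚ.∣i∣≡0⇒i≡0 (reduce (ℕₚ.m*n≡0⇒m≡0∨n≡0 _ (ℕₚ.m+n≡0⇒m≡0 _ N≡0)))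
    a≡0 : a ≡ + 0
    a≡0 = [ (λ ()) , (λ a≡0 → a≡0) ]′ (ℤₚ.i*j≡0⇒i≡0∨j≡0 (+ 2) (trans (sym (ℤₚ.+-identityʳ _)) 2a+0≡0))

  ⊛-cancelˡ : ∀ {α u v} → α ≢ 0K m → α ⊛ u ≡ α ⊛ v → u ≡ v
  ⊛-cancelˡ {α} {u} {v} α≢0 αu≡αv =
    [ (λ Nα≡0 → contradiction (norm4≡0⇒≡0 α Nα≡0) α≢0) , (λ N≡0 → ⊝≡0⇒≡ u v (norm4≡0⇒≡0 (u ⊝ v) N≡0)) ]′
      (ℕₚ.m*n≡0⇒m≡0∨n≡0 (norm4 α) norms≡0)
    where
    open ≡-Reasoning
    norms≡0 : norm4 α ℕ.* norm4 (u ⊝ v) ≡ 0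
    norms≡0 = begin
      norm4 α ℕ.* norm4 (u ⊝ v)  ≡⟨ sym (norm4-⊛ α (u ⊝ v)) ⟩
      4 ℕ.* norm4 (α ⊛ (u ⊝ v))  ≡⟨ cong (λ w → 4 ℕ.* norm4 w) (⊛-distribˡ-⊝ α u v) ⟩
      4 ℕ.* norm4 (α ⊛ u ⊝ α ⊛ v) ≡⟨ cong (λ w → 4 ℕ.* norm4 (w ⊝ α ⊛ v)) αu≡αv ⟩
      4 ℕ.* norm4 (α ⊛ v ⊝ α ⊛ v) ≡⟨ cong (λ w → 4 ℕ.* norm4 w) (⊝-self (α ⊛ v)) ⟩
      4 ℕ.* (m ℕ.* 0)             ≡⟨ cong (4 ℕ.*_) (ℕₚ.*-zeroʳ m) ⟩
      0                           ∎

  -- Norms rule out a factorisation 4 = x y with both factors irrational: it would give 16 = N x N y with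
  -- 4 N x, 4 N y ≥ m ≥ 17.
  ⊛≡4⇒rational : ∀ x y → x ⊛ y ≡ (+ 4 , + 0) → proj₂ x ≡ + 0
  ⊛≡4⇒rational (a , b) (c , e) xy≡4 with b ℤ.≟ + 0 | e ℤ.≟ + 0
  ... | yes b≡0 | _        = b≡0
  ... | no b≢0  | yes refl = contradiction (trans (sym (cong proj₁ xy≡4)) (first c≡0)) (λ ())
    where
    second : ∀ a b c → a ℤ.* + 0 ℤ.+ b ℤ.* c ℤ.+ b ℤ.* + 0 ≡ b ℤ.* c
    second = solve-∀
    c≡0 : c ≡ + 0
    c≡0 = [ (λ b≡0 → contradiction b≡0 b≢0) , (λ c≡0 → c≡0) ]′
      (ℤₚ.i*j≡0⇒i≡0∨j≡0 b (trans (sym (second a b c)) (cong proj₂ xy≡4)))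
    first : c ≡ + 0 → a ℤ.* c ℤ.- K ℤ.* (b ℤ.* + 0) ≡ + 0
    first refl = identity a b K
      where
      identity : ∀ a b K → a ℤ.* + 0 ℤ.- K ℤ.* (b ℤ.* + 0) ≡ + 0
      identity = solve-∀
  ... | no b≢0  | no e≢0   = ⊥-elim (ℕₚ.<⇒≱ (ℕₚ.m≤m+n 257 32) (begin
    17 ℕ.* 17                        ≤⟨ ℕₚ.*-mono-≤ 16<m 16<m ⟩
    m ℕ.* m                          ≤⟨ ℕₚ.*-mono-≤ (m≤norm4 a b b≢0) (m≤norm4 c e e≢0) ⟩
    norm4 (a , b) ℕ.* norm4 (c , e)  ≡⟨ sym (norm4-⊛ (a , b) (c , e)) ⟩
    4 ℕ.* norm4 ((a , b) ⊛ (c , e))  ≡⟨ cong (λ w → 4 ℕ.* norm4 w) xy≡4 ⟩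
    4 ℕ.* (64 ℕ.+ m ℕ.* 0)           ≡⟨ cong (λ n → 4 ℕ.* (64 ℕ.+ n)) (ℕₚ.*-zeroʳ m) ⟩
    256                              ∎))
    where open ℕₚ.≤-Reasoning

  Principal : Sub m → Set
  Principal J = Σ OK λ x → J x × ∀ y → J y → Σ OK λ z → y ≡ x ⊛ z

  SameClass-Unit⇒Principal : ∀ J → SameClass m J (Unit m) → Principal J
  SameClass-Unit⇒Principal J (α , β , α≢0 , _ , αJ≈βO)
    with proj₂ (αJ≈βO β) (1K m , tt , sym (⊛-identityʳ β))
  ... | x , x∈J , β≡αx = x , x∈J , quotient
    where
    quotient : ∀ y → J y → Σ OK λ z → y ≡ x ⊛ z
    quotient y y∈J with proj₁ (αJ≈βO (α ⊛ y)) (y , y∈J , refl)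
    ... | z , _ , αy≡βz = z , ⊛-cancelˡ α≢0 (begin
      α ⊛ y        ≡⟨ αy≡βz ⟩
      β ⊛ z        ≡⟨ cong (_⊛ z) β≡αx ⟩
      α ⊛ x ⊛ z    ≡⟨ ⊛-assoc α x z ⟩
      α ⊛ (x ⊛ z)  ∎)
      where open ≡-Reasoning

  ¬Principal : (J : Sub m) (g : OK) → J (+ 4 , + 0) → J g → ¬ Even (proj₂ g) →
               (∀ a → J (a , + 0) → Even a) → ¬ Principal J
  ¬Principal J g 4∈J g∈J g-odd rational-even ((a , b) , x∈J , divides)
    with divides _ 4∈J | divides _ g∈J
  ... | y , 4≡xy | (d , e) , g≡xz with ⊛≡4⇒rational (a , b) y (sym 4≡xy)
  ... | refl = g-odd (subst Even (sym (trans (cong proj₂ g≡xz) (identity a d e)))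
                       (ℤ∣.∣n⇒∣m*n e (rational-even a x∈J)))
    where
    identity : ∀ a d e → a ℤ.* e ℤ.+ + 0 ℤ.* d ℤ.+ + 0 ℤ.* e ≡ e ℤ.* a
    identity = solve-∀

  ¬ClassInE-𝔭 : (I : Ideal m) (c : ℤ) → Root c → mem I (+ 2 , + 0) → mem I (c −ω) →
                (∀ {u} → mem I u → Even (eval c u)) → ¬ ClassInE m (mem I)
  ¬ClassInE-𝔭 I c root 2∈I w∈I I⊆𝔭 I²~O =
    ¬Principal I² ((c −ω) ⊛ (c −ω)) (subst I² 2⊛2≡4 (∈· (mem I) (mem I) 2∈I 2∈I))
      (∈· (mem I) (mem I) w∈I w∈I) (¬Even-ω-part-of-[c−ω]² c)
      (λ a a∈I² → Even-eval-rational c a (·-⊆ʳ (mem I) (mem I) (𝔭 c root) I⊆𝔭 a∈I²))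
      (SameClass-Unit⇒Principal I² I²~O)
    where
    I² = _·_ m (mem I) (mem I)

  ¬ClassInE-prime-above-2 : Even K → (P : Ideal m) → IsNonzeroPrime m P → LiesAbove m P 2 →
                            ¬ ClassInE m (mem P)
  ¬ClassInE-prime-above-2 k-even P prime@(_ , 1∉P , _) 2∈P with prime-above-2 k-even P prime 2∈P
  ... | inj₁ w∈P = ¬ClassInE-𝔭 P (+ 0) (Even-k⇒Root-0 k-even) 2∈P w∈P (⊆𝔭 P 2∈P 1∉P (+ 0) w∈P)
  ... | inj₂ w∈P = ¬ClassInE-𝔭 P (+ 1) (Even-k⇒Root-1 k-even) 2∈P w∈P (⊆𝔭 P 2∈P 1∉P (+ 1) w∈P)

claim1 : (m : ℕ) → 16 < m → SquareFree m → 8 ∣ suc m →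
    ((l : Lifting m) → (p2 : Prime 2) → ¬ InL0 m l 2 p2) × EProper m
claim1 m 16<m _ (ℕ∣.divides j 1+m≡j*8) = not-in-L0 , 𝔭₀ , 𝔭₀≢0 , ¬ClassInE-𝔭₀
  where
  1+m≡2j*4 : suc m ≡ (j ℕ.* 2) ℕ.* 4
  1+m≡2j*4 = trans 1+m≡j*8 (sym (ℕₚ.*-assoc j 2 4))
  open Arithmetic m
  open Classes m (m≡4k-1 (j ℕ.* 2) 1+m≡2j*4) 16<m
  k-even : Even K
  k-even = ℤ∣.divides (+ j) (trans (kOf-≡ (j ℕ.* 2) 1+m≡2j*4) (ℤₚ.pos-* j 2))
  not-in-L0 : (l : Lifting m) (p2 : Prime 2) → ¬ InL0 m l 2 p2
  not-in-L0 l p2 (l2∈E , _) =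
    ¬ClassInE-prime-above-2 k-even (lift l 2 p2) (liftPrime l 2 p2) (liftAbove l 2 p2) l2∈E
  𝔭₀ : Ideal m
  𝔭₀ = 𝔭 (+ 0) (Even-k⇒Root-0 k-even)
  𝔭₀≢0 : NonzeroSub m (mem 𝔭₀)
  𝔭₀≢0 = (+ 2 , + 0) , ℤ∣.divides (+ 1) refl , λ ()
  ¬ClassInE-𝔭₀ : ¬ ClassInE m (mem 𝔭₀)
  ¬ClassInE-𝔭₀ = ¬ClassInE-𝔭 𝔭₀ (+ 0) (Even-k⇒Root-0 k-even)
    (ℤ∣.divides (+ 1) refl) (ℤ∣.divides (+ 0) refl) (λ u∈𝔭₀ → u∈𝔭₀)
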